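{- Let $\varphi$ be a skew morphism of a finite cyclic group $B$ and let $\overline{\varphi}$ be the quotient of $\varphi$ with respect to some generator of $B$. Then $\varphi$ is an automorphism of $B$ if and only if $\overline{\varphi}$ is the identity mapping.
   Context: For a finite group $B$, a skew morphism of $B$ is a permutation $\varphi$ of $B$ fixing the identity such that for every $a\in B$ there is a positive integer $i_a$ with $\varphi(ab)=\varphi(a)\varphi^{i_a}(b)$ for all $b\in B$; the power function $\pi$ maps $a$ to the unique such $i_a\in\{1,\dots,\mathrm{ord}(\varphi)\}$ where $\mathrm{ord}(\varphi)=|\langle\varphi\rangle|$ (with $\pi\equiv1$ for the identity); $\ker\varphi=\{a:\pi(a)=1\}$. Quotient: for $B$ cyclic, identify $B$ with its left regular action in $\mathrm{Sym}(B)$, let $C=\langle\varphi\rangle$ and $G=BC\le\mathrm{Sym}(B)$ (with $B\cap C=1$). Then $K=\ker\varphi$ is normal in $G$. Write $\overline{g}=gK$, $\overline{X}=XK/K$; $\overline C\cong C$ and $\overline B\cap\overline C=1$. For a generator $b$ of $B$, each $\overline{d}\in\overline{C}$ satisfies $\overline{d}\,\overline{b}=\overline{b}^{\,j}\overline{d'}$ for unique $\overline{d'}\in\overline{C}$ and $j\in\{1,\dots,|\overline B|\}$; the map $\overline\varphi:\overline d\mapsto\overline{d'}$ (a skew morphism of $\overline C$ with power function $\overline d\mapsto j$) is the quotient of $\varphi$ with respect to $b$. -}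

module Defs where

open import Data.Nat using (ℕ; zero; suc; _*_; _≤_)
import Data.Nat as ℕ
open import Data.Nat.DivMod using (_mod_)
open import Data.Fin using (Fin; toℕ)
import Data.Fin as Fin
open import Data.Product using (Σ; ∃; _×_; _,_)
open import Relation.Binary.PropositionalEquality using (_≡_)
open import Function.Definitions using (Bijective)

-- The finite cyclic group B of order n = suc m, realised as ℤ/nℤ on Fin n.
B : ℕ → Set
B m = Fin (suc m)

e : ∀ {m} → B m
e = Fin.zero

_⊕_ : ∀ {m} → B m → B m → B m
_⊕_ {m} a c = (toℕ a ℕ.+ toℕ c) mod (suc m)

-- j-th power of an element c of B (written additively: j·c).
_·_ : ∀ {m} → ℕ → B m → B m
_·_ {m} j c = (j * toℕ c) mod (suc m)

iter : ∀ {A : Set} → (A → A) → ℕ → A → A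
iter f zero x = x
iter f (suc i) x = f (iter f i x)

IsSkewMorphism : ∀ m → (B m → B m) → Set
IsSkewMorphism m φ =
  Bijective _≡_ _≡_ φ × φ e ≡ e ×
  (∀ (a : B m) → Σ ℕ λ i → (1 ≤ i) × (∀ (c : B m) → φ (a ⊕ c) ≡ φ a ⊕ iter φ i c))

-- Automorphism of B (φ is already a permutation)
IsAutomorphism : ∀ m → (B m → B m) → Set
IsAutomorphism m φ = ∀ (a c : B m) → φ (a ⊕ c) ≡ φ a ⊕ φ c

IsGenerator : ∀ m → B m → Set
IsGenerator m b = ∀ (a : B m) → ∃ λ j → a ≡ j · b

-- Kernel of φ: π(a) = 1, i.e. exponent 1 satisfies the skew identity for a
InKer : ∀ m → (B m → B m) → B m → Set
InKer m φ a = ∀ (c : B m) → φ (a ⊕ c) ≡ φ a ⊕ φ c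

trans : ∀ {m} → B m → B m → B m
trans a x = a ⊕ x

-- Cosets modulo K = ker φ (K acting on the right as left translations):
-- gK = hK  iff  h = g ∘ t_k for some k ∈ K
SameCoset : ∀ m → (B m → B m) → (g h : B m → B m) → Set
SameCoset m φ g h = Σ (B m) λ k → InKer m φ k × (∀ (x : B m) → h x ≡ g (trans k x))

-- The quotient relation with respect to the generator b:
-- for d = φ^i, d' = φ^i' in C:  d̄ b̄ = b̄^j d̄'   (as cosets of K in G)
QuotRel : ∀ m → (B m → B m) → (b : B m) → (i i' j : ℕ) → Set
QuotRel m φ b i i' j =
  SameCoset m φ (λ x → iter φ i (trans b x)) (λ x → trans (j · b) (iter φ i' x))

-- The quotient φ̄ is the identity mapping of C̄:
-- whenever φ̄(d̄) = d̄' (i.e. d̄ b̄ = b̄^j d̄'), we have d̄' = d̄.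
QuotientIsIdentity : ∀ m → (B m → B m) → (b : B m) → Set
QuotientIsIdentity m φ b =
  ∀ (i i' j : ℕ) → QuotRel m φ b i i' j → SameCoset m φ (iter φ i) (iter φ i')

{-# OPTIONS --safe #-}
module Submission where

open import Defs hiding (trans)
open import Data.Nat using (ℕ; NonZero; zero; suc; _+_; _*_; _%_; _∸_)
open import Data.Nat.Properties using (+-assoc; +-identityʳ; m∸n+n≡m; <⇒≤)
open import Data.Nat.DivMod using (_mod_; %-distribˡ-+; m%n%n≡m%n; m%n<n; m<n⇒m%n≡m; n%n≡0)
open import Data.Fin using (toℕ)
open import Data.Fin.Properties using (toℕ-injective; toℕ-fromℕ<; toℕ<n)
open import Data.Product using (∃; _,_)
open import Function.Bundles using (_⇔_; mk⇔)
open import Relation.Binary.PropositionalEquality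
  using (_≡_; refl; sym; trans; cong; subst; module ≡-Reasoning)

-- If φ is an automorphism, so is every power ψ = φ^i. A relation
-- ψ ∘ t_b ≡ t_{j·b} ∘ φ^i′ modulo K, evaluated at e, identifies the two
-- translation parts (both maps fix e), and cancelling them gives φ^i′ = ψ,
-- so φ̄ is trivial. Conversely, the skew identity φ(b + x) = φ b + φ^p x with
-- φ b = j·b says that φ̄ sends φ̄ to φ̄^p. If φ̄ is trivial then φ^p = φ ∘ t_k
-- for some k ∈ K, and φ k = e because both sides fix e; hence φ^p = φ, so
-- b ∈ K, and K, being closed under addition, contains every multiple of b.

%-absorbˡ-+ : ∀ x y d .{{_ : NonZero d}} → (x % d + y) % d ≡ (x + y) % d
%-absorbˡ-+ x y d = begin
  (x % d + y) % d         ≡⟨ %-distribˡ-+ (x % d) y d ⟩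
  (x % d % d + y % d) % d ≡⟨ cong (λ z → (z + y % d) % d) (m%n%n≡m%n x d) ⟩
  (x % d + y % d) % d     ≡⟨ sym (%-distribˡ-+ x y d) ⟩
  (x + y) % d             ∎
  where open ≡-Reasoning

%-absorbʳ-+ : ∀ x y d .{{_ : NonZero d}} → (x + y % d) % d ≡ (x + y) % d
%-absorbʳ-+ x y d = begin
  (x + y % d) % d         ≡⟨ %-distribˡ-+ x (y % d) d ⟩
  (x % d + y % d % d) % d ≡⟨ cong (λ z → (x % d + z) % d) (m%n%n≡m%n y d) ⟩
  (x % d + y % d) % d     ≡⟨ sym (%-distribˡ-+ x y d) ⟩
  (x + y) % d             ∎
  where open ≡-Reasoning

iter-fix : ∀ {A : Set} (f : A → A) {x : A} → f x ≡ x → ∀ i → iter f i x ≡ x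
iter-fix f fx≡x zero    = refl
iter-fix f fx≡x (suc i) = trans (cong f (iter-fix f fx≡x i)) fx≡x

module _ {m : ℕ} where

  private
    N : ℕ
    N = suc m

  toℕ-mod : ∀ x → toℕ (x mod N) ≡ x % N
  toℕ-mod x = toℕ-fromℕ< (m%n<n x N)

  %≡⇒mod≡ : ∀ x y → x % N ≡ y % N → x mod N ≡ y mod N
  %≡⇒mod≡ x y eq = toℕ-injective (trans (toℕ-mod x) (trans eq (sym (toℕ-mod y))))

  mod-toℕ : ∀ (a : B m) → toℕ a mod N ≡ a
  mod-toℕ a = toℕ-injective (trans (toℕ-mod (toℕ a)) (m<n⇒m%n≡m (toℕ<n a)))

  ⊕-identityˡ : ∀ (a : B m) → e ⊕ a ≡ a
  ⊕-identityˡ = mod-toℕ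

  ⊕-identityʳ : ∀ (a : B m) → a ⊕ e ≡ a
  ⊕-identityʳ a = trans (cong (_mod N) (+-identityʳ (toℕ a))) (mod-toℕ a)

  ⊕-assoc : ∀ (a c d : B m) → (a ⊕ c) ⊕ d ≡ a ⊕ (c ⊕ d)
  ⊕-assoc a c d = %≡⇒mod≡ (toℕ (a ⊕ c) + D) (A + toℕ (c ⊕ d)) (begin
    (toℕ (a ⊕ c) + D) % N   ≡⟨ cong (λ z → (z + D) % N) (toℕ-mod (A + C)) ⟩
    ((A + C) % N + D) % N   ≡⟨ %-absorbˡ-+ (A + C) D N ⟩
    (A + C + D) % N         ≡⟨ cong (_% N) (+-assoc A C D) ⟩
    (A + (C + D)) % N       ≡⟨ %-absorbʳ-+ A (C + D) N ⟨
    (A + (C + D) % N) % N   ≡⟨ cong (λ z → (A + z) % N) (toℕ-mod (C + D)) ⟨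
    (A + toℕ (c ⊕ d)) % N   ∎)
    where
      open ≡-Reasoning
      A C D : ℕ
      A = toℕ a
      C = toℕ c
      D = toℕ d

  ⊖_ : B m → B m
  ⊖ a = (N ∸ toℕ a) mod N

  ⊕-inverseˡ : ∀ (a : B m) → (⊖ a) ⊕ a ≡ e
  ⊕-inverseˡ a = %≡⇒mod≡ (toℕ (⊖ a) + A) 0 (begin
    (toℕ (⊖ a) + A) % N     ≡⟨ cong (λ z → (z + A) % N) (toℕ-mod (N ∸ A)) ⟩
    ((N ∸ A) % N + A) % N   ≡⟨ %-absorbˡ-+ (N ∸ A) A N ⟩
    (N ∸ A + A) % N         ≡⟨ cong (_% N) (m∸n+n≡m (<⇒≤ (toℕ<n a))) ⟩
    N % N                   ≡⟨ n%n≡0 N ⟩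
    0                       ∎)
    where
      open ≡-Reasoning
      A : ℕ
      A = toℕ a

  ⊕-cancelˡ : ∀ (a : B m) {c d : B m} → a ⊕ c ≡ a ⊕ d → c ≡ d
  ⊕-cancelˡ a {c} {d} eq = begin
    c               ≡⟨ ⊕-identityˡ c ⟨
    e ⊕ c           ≡⟨ cong (_⊕ c) (⊕-inverseˡ a) ⟨
    ((⊖ a) ⊕ a) ⊕ c ≡⟨ ⊕-assoc (⊖ a) a c ⟩
    (⊖ a) ⊕ (a ⊕ c) ≡⟨ cong ((⊖ a) ⊕_) eq ⟩
    (⊖ a) ⊕ (a ⊕ d) ≡⟨ ⊕-assoc (⊖ a) a d ⟨
    ((⊖ a) ⊕ a) ⊕ d ≡⟨ cong (_⊕ d) (⊕-inverseˡ a) ⟩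
    e ⊕ d           ≡⟨ ⊕-identityˡ d ⟩
    d               ∎
    where open ≡-Reasoning

  ·-suc : ∀ j (b : B m) → suc j · b ≡ b ⊕ (j · b)
  ·-suc j b = %≡⇒mod≡ (toℕ b + j * toℕ b) (toℕ b + toℕ (j · b)) (begin
    (toℕ b + j * toℕ b) % N       ≡⟨ %-absorbʳ-+ (toℕ b) (j * toℕ b) N ⟨
    (toℕ b + j * toℕ b % N) % N   ≡⟨ cong (λ z → (toℕ b + z) % N) (toℕ-mod (j * toℕ b)) ⟨
    (toℕ b + toℕ (j · b)) % N     ∎)
    where open ≡-Reasoning

  ⊕-cancel-translations : ∀ {f g : B m → B m} (c d : B m) → f e ≡ e → g e ≡ e →
    (∀ x → c ⊕ f x ≡ d ⊕ g x) → ∀ x → f x ≡ g x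
  ⊕-cancel-translations {f} {g} c d fe≡e ge≡e eq x =
    ⊕-cancelˡ c (trans (eq x) (cong (_⊕ g x) (sym c≡d)))
    where
      c≡d : c ≡ d
      c≡d = begin
        c       ≡⟨ sym (⊕-identityʳ c) ⟩
        c ⊕ e   ≡⟨ cong (c ⊕_) (sym fe≡e) ⟩
        c ⊕ f e ≡⟨ eq e ⟩
        d ⊕ g e ≡⟨ cong (d ⊕_) ge≡e ⟩
        d ⊕ e   ≡⟨ ⊕-identityʳ d ⟩
        d       ∎
        where open ≡-Reasoning

  iter-automorphism : ∀ {φ : B m → B m} → IsAutomorphism m φ →
    ∀ i → IsAutomorphism m (iter φ i)
  iter-automorphism     aut zero    a c = refl
  iter-automorphism {φ} aut (suc i) a c =
    trans (cong φ (iter-automorphism aut i a c)) (aut (iter φ i a) (iter φ i c))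

  module _ (φ : B m → B m) (φe≡e : φ e ≡ e) where

    InKer-e : InKer m φ e
    InKer-e c = begin
      φ (e ⊕ c) ≡⟨ cong φ (⊕-identityˡ c) ⟩
      φ c       ≡⟨ sym (⊕-identityˡ (φ c)) ⟩
      e ⊕ φ c   ≡⟨ cong (_⊕ φ c) (sym φe≡e) ⟩
      φ e ⊕ φ c ∎
      where open ≡-Reasoning

    InKer-⊕ : ∀ {k l} → InKer m φ k → InKer m φ l → InKer m φ (k ⊕ l)
    InKer-⊕ {k} {l} k∈K l∈K x = begin
      φ ((k ⊕ l) ⊕ x)     ≡⟨ cong φ (⊕-assoc k l x) ⟩
      φ (k ⊕ (l ⊕ x))     ≡⟨ k∈K (l ⊕ x) ⟩
      φ k ⊕ φ (l ⊕ x)     ≡⟨ cong (φ k ⊕_) (l∈K x) ⟩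
      φ k ⊕ (φ l ⊕ φ x)   ≡⟨ sym (⊕-assoc (φ k) (φ l) (φ x)) ⟩
      (φ k ⊕ φ l) ⊕ φ x   ≡⟨ cong (_⊕ φ x) (sym (k∈K l)) ⟩
      φ (k ⊕ l) ⊕ φ x     ∎
      where open ≡-Reasoning

    InKer-· : ∀ {b} → InKer m φ b → ∀ j → InKer m φ (j · b)
    InKer-· b∈K zero    = InKer-e
    InKer-· {b} b∈K (suc j) =
      subst (InKer m φ) (sym (·-suc j b)) (InKer-⊕ b∈K (InKer-· b∈K j))

    generator∈ker⇒automorphism : ∀ {b} → IsGenerator m b → InKer m φ b → IsAutomorphism m φ
    generator∈ker⇒automorphism gen b∈K a with gen a
    ... | j , refl = InKer-· b∈K j

    pointwise⇒SameCoset : ∀ {g h : B m → B m} → (∀ x → h x ≡ g x) → SameCoset m φ g h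
    pointwise⇒SameCoset {g} h≗g =
      e , InKer-e , λ x → trans (h≗g x) (cong g (sym (⊕-identityˡ x)))

    SameCoset-φ⇒≗φ : ∀ {h : B m → B m} → SameCoset m φ φ h → h e ≡ e → ∀ x → h x ≡ φ x
    SameCoset-φ⇒≗φ {h} (k , k∈K , h≗φ∘tk) he≡e x = begin
      h x           ≡⟨ h≗φ∘tk x ⟩
      φ (k ⊕ x)     ≡⟨ k∈K x ⟩
      φ k ⊕ φ x     ≡⟨ cong (λ z → z ⊕ φ x) φk≡e ⟩
      e ⊕ φ x       ≡⟨ ⊕-identityˡ (φ x) ⟩
      φ x           ∎
      where
        open ≡-Reasoning
        φk≡e : φ k ≡ e
        φk≡e = begin
          φ k       ≡⟨ cong φ (sym (⊕-identityʳ k)) ⟩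
          φ (k ⊕ e) ≡⟨ sym (h≗φ∘tk e) ⟩
          h e       ≡⟨ he≡e ⟩
          e         ∎

    automorphism⇒quotient-identity : IsAutomorphism m φ → ∀ b → QuotientIsIdentity m φ b
    automorphism⇒quotient-identity aut b i i′ j (k , _ , rel) =
      pointwise⇒SameCoset
        (⊕-cancel-translations (j · b) (iter φ i (b ⊕ k))
          (iter-fix φ φe≡e i′) (iter-fix φ φe≡e i) λ x →
            trans (rel x)
              (trans (cong (iter φ i) (sym (⊕-assoc b k x)))
                     (iter-automorphism aut i (b ⊕ k) x)))

    quotient-identity⇒InKer : ∀ {b} p → (∀ c → φ (b ⊕ c) ≡ φ b ⊕ iter φ p c) →
      ∃ (λ j → φ b ≡ j · b) → QuotientIsIdentity m φ b → InKer m φ b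
    quotient-identity⇒InKer {b} p skew (j , φb≡jb) φ̄≗id c =
      trans (skew c) (cong (φ b ⊕_) (φᵖ≗φ c))
      where
        φb̄≡b̄ʲφ̄ᵖ : QuotRel m φ b 1 p j
        φb̄≡b̄ʲφ̄ᵖ = pointwise⇒SameCoset λ x →
          trans (cong (_⊕ iter φ p x) (sym φb≡jb)) (sym (skew x))
        φᵖ≗φ : ∀ x → iter φ p x ≡ φ x
        φᵖ≗φ = SameCoset-φ⇒≗φ (φ̄≗id 1 p j φb̄≡b̄ʲφ̄ᵖ) (iter-fix φ φe≡e p)

lemma4p2 : (m : ℕ) (φ : B m → B m) → IsSkewMorphism m φ →
    (b : B m) → IsGenerator m b →
    IsAutomorphism m φ ⇔ QuotientIsIdentity m φ b
lemma4p2 m φ (_ , φe≡e , skew) b gen with skew b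
... | p , _ , φ-skew-at-b = mk⇔
  (λ aut → automorphism⇒quotient-identity φ φe≡e aut b)
  (λ φ̄≗id → generator∈ker⇒automorphism φ φe≡e gen
    (quotient-identity⇒InKer φ φe≡e p φ-skew-at-b (gen (φ b)) φ̄≗id))
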